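{- Let $v$ be a Lyndon word containing at least two distinct letters, and let ${\tt x}$ be a letter smaller than or equal to the smallest character occurring in $v$. Then $r(v)\le r({\tt x}v)=r(v{\tt x})\le r(v)+2$.
   Context: Words are over a finite totally ordered alphabet. A Lyndon word is a word strictly lexicographically smaller than all of its other conjugates. For a word $w$, $\mathrm{BWT}(w)$ is obtained by sorting the conjugates $w[i..n-1]w[0..i-1]$ lexicographically and concatenating their last characters; $r(w)$ is the number of maximal equal-letter runs of $\mathrm{BWT}(w)$. -}

module Defs where

open import Data.Nat using (ℕ; zero; suc; _<_; _≤_; _≤ᵇ_; _≡ᵇ_; _+_)
open import Data.Bool using (Bool; true; false; if_then_else_)
open import Data.List using (List; []; _∷_; _++_; take; drop; length; map; upTo; last)
open import Data.Maybe using (Maybe; just; nothing)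
open import Data.Product using (_×_; ∃-syntax)
open import Relation.Binary.PropositionalEquality using (_≡_; _≢_)
open import Data.List.Membership.Propositional using (_∈_)

Word : Set
Word = List ℕ

data _<ₗ_ : Word → Word → Set where
  []<∷  : ∀ {b v} → [] <ₗ (b ∷ v)
  here  : ∀ {a b u v} → a < b → (a ∷ u) <ₗ (b ∷ v)
  there : ∀ {a u v} → u <ₗ v → (a ∷ u) <ₗ (a ∷ v)

_≤ₗᵇ_ : Word → Word → Bool
[] ≤ₗᵇ _ = true
(a ∷ u) ≤ₗᵇ [] = false
(a ∷ u) ≤ₗᵇ (b ∷ v) =
  if a ≡ᵇ b then u ≤ₗᵇ v else (a ≤ᵇ b)

rot : ℕ → Word → Word
rot i w = drop i w ++ take i w

conjugates : Word → List Word
conjugates w = map (λ i → rot i w) (upTo (length w))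

IsLyndon : Word → Set
IsLyndon w = (0 < length w) × (∀ i → 0 < i → i < length w → w <ₗ rot i w)

insert : Word → List Word → List Word
insert u [] = u ∷ []
insert u (v ∷ vs) = if u ≤ₗᵇ v then u ∷ v ∷ vs else v ∷ insert u vs

sortW : List Word → List Word
sortW [] = []
sortW (u ∷ us) = insert u (sortW us)

-- Last characters of a list of words (conjugates of a nonempty word are nonempty).
lastChars : List Word → List ℕ
lastChars [] = []
lastChars (u ∷ us) with last u
... | just c  = c ∷ lastChars us
... | nothing = lastChars us

BWT : Word → Word
BWT w = lastChars (sortW (conjugates w))

runsFrom : ℕ → Word → ℕ
runsFrom a [] = 0
runsFrom a (b ∷ u) = if a ≡ᵇ b then runsFrom b u else suc (runsFrom b u)

runs : Word → ℕ
runs [] = 0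
runs (a ∷ u) = suc (runsFrom a u)

r : Word → ℕ
r w = runs (BWT w)

HasTwoDistinct : Word → Set
HasTwoDistinct v = ∃[ a ] ∃[ b ] (a ∈ v × b ∈ v × a ≢ b)

LeAll : ℕ → Word → Set
LeAll x v = ∀ {c} → c ∈ v → x ≤ c

{-# OPTIONS --safe #-}
-- For a split v = t r with r nonempty, r t is a conjugate of v; the conjugates of v x are
-- the words r x t together with x v, and x v has exactly the same conjugates.  Because v
-- is Lyndon, v and x v are smaller than each proper suffix c of v, at a position inside c.
-- Hence two conjugates r t and r′ t′ of v compare either by a mismatch inside r, r′ or,
-- when r′ = r c, by t ≺ c; since also x t ≺ c, inserting x at the seams keeps the order.
-- Moreover x v is the least of these words and v x (the case t = []) the next one.
-- Reading off last letters, BWT(v) = L B yields BWT(x v) = BWT(v x) = L x B, and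
-- inserting one letter into a word adds 0, 1 or 2 runs.
module Submission where

open import Defs
open import Data.Nat using (ℕ; _≤_; _+_)
open import Data.List using (_∷_; []; _++_)
open import Data.Product using (_×_)
open import Relation.Binary.PropositionalEquality using (_≡_)

open import Data.Bool using (Bool; true; false; T; if_then_else_)
open import Data.Bool.Properties using (T-≡)
open import Data.Empty using (⊥-elim)
open import Data.List using (List; length; map; take; drop; last; applyUpTo; upTo)
open import Data.List.Properties
  using (length-++; length-++-comm; length-++-≤ʳ; ++-identityʳ; ++-assoc; ++-cancelʳ; ++-conicalʳ;
         take-all; drop-all; take++drop≡id; map-++; map-cong-local; map-applyUpTo; upTo-∷ʳ)
open import Data.List.Relation.Unary.All as All using (All; []; _∷_)
open import Data.List.Relation.Unary.All.Properties using (applyUpTo⁺₁; map⁺)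
open import Data.List.Relation.Unary.Any using (here; there)
open import Data.Maybe using (just; nothing)
open import Data.Nat using (suc; _<_; _≡ᵇ_; _≤ᵇ_; _≟_; z≤n; s≤s)
open import Data.Nat.Properties
  using (≡⇒≡ᵇ; ≡ᵇ⇒≡; ≤⇒≤ᵇ; ≤ᵇ⇒≤; <⇒≢; >⇒≢; <⇒≤; <⇒≱; <-irrefl; <-asym; <-cmp; ≤-<-trans;
         ≤-refl; ≤-reflexive; ≤-trans; m≤n⇒m<n∨m≡n; m≤n⇒m≤1+n; n≤1+n; m≤m+n; m<m+n;
         suc-injective; +-comm; +-cancelʳ-≡; +-cancelʳ-≤; module ≤-Reasoning)
open import Data.Product using (_,_; proj₁; proj₂; ∃-syntax)
open import Data.Sum using (_⊎_; inj₁; inj₂)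
open import Function using (_∘_; id)
open import Function.Bundles using (Equivalence)
open import Relation.Binary.Definitions using (tri<; tri≈; tri>)
open import Relation.Binary.PropositionalEquality
  using (refl; sym; trans; cong; cong₂; subst; _≢_; module ≡-Reasoning)
open import Relation.Nullary using (¬_; yes; no)

¬T⇒≡false : ∀ {b} → ¬ T b → b ≡ false
¬T⇒≡false {false} _  = refl
¬T⇒≡false {true}  ¬t = ⊥-elim (¬t _)

≡ᵇ-refl : ∀ n → (n ≡ᵇ n) ≡ true
≡ᵇ-refl n = Equivalence.to T-≡ (≡⇒≡ᵇ n n refl)

≢⇒≡ᵇ-false : ∀ {m n} → m ≢ n → (m ≡ᵇ n) ≡ false
≢⇒≡ᵇ-false {m} {n} m≢n = ¬T⇒≡false (m≢n ∘ ≡ᵇ⇒≡ m n)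

≤⇒≤ᵇ-true : ∀ {m n} → m ≤ n → (m ≤ᵇ n) ≡ true
≤⇒≤ᵇ-true = Equivalence.to T-≡ ∘ ≤⇒≤ᵇ

>⇒≤ᵇ-false : ∀ {m n} → n < m → (m ≤ᵇ n) ≡ false
>⇒≤ᵇ-false {m} {n} n<m = ¬T⇒≡false (<⇒≱ n<m ∘ ≤ᵇ⇒≤ m n)

-- u ≺ w: u is smaller than w at the first position where they differ.  Unlike _<ₗ_,
-- which also relates a word to its proper extensions, ≺ survives appending to both sides.
infix 4 _≺_
data _≺_ : Word → Word → Set where
  ≺-here  : ∀ {a b u w} → a < b → (a ∷ u) ≺ (b ∷ w)
  ≺-there : ∀ {a u w} → u ≺ w → (a ∷ u) ≺ (a ∷ w)

≺-irrefl : ∀ {u} → ¬ u ≺ u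
≺-irrefl (≺-here a<a) = <-irrefl refl a<a
≺-irrefl (≺-there p)  = ≺-irrefl p

≺-asym : ∀ {u w} → u ≺ w → ¬ w ≺ u
≺-asym (≺-here a<b) (≺-here b<a) = <-asym a<b b<a
≺-asym (≺-here a<a) (≺-there _)  = <-irrefl refl a<a
≺-asym (≺-there _)  (≺-here a<a) = <-irrefl refl a<a
≺-asym (≺-there p)  (≺-there q)  = ≺-asym p q

≺-nonemptyˡ : ∀ {u w} → u ≺ w → u ≢ []
≺-nonemptyˡ (≺-here _)  ()
≺-nonemptyˡ (≺-there _) ()

≺-nonemptyʳ : ∀ {u w} → u ≺ w → w ≢ []
≺-nonemptyʳ (≺-here _)  ()
≺-nonemptyʳ (≺-there _) ()

≺-extend : ∀ {u w} s t → u ≺ w → (u ++ s) ≺ (w ++ t)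
≺-extend s t (≺-here a<b) = ≺-here a<b
≺-extend s t (≺-there p)  = ≺-there (≺-extend s t p)

≺-extendʳ : ∀ {u w} t → u ≺ w → u ≺ (w ++ t)
≺-extendʳ t (≺-here a<b) = ≺-here a<b
≺-extendʳ t (≺-there p)  = ≺-there (≺-extendʳ t p)

≺-prepend : ∀ k {u w} → u ≺ w → (k ++ u) ≺ (k ++ w)
≺-prepend []      p = p
≺-prepend (a ∷ k) p = ≺-there (≺-prepend k p)

≺-truncate : ∀ u₁ u₂ w → (u₁ ++ u₂) ≺ w → length w ≤ length u₁ → u₁ ≺ w
≺-truncate []       _  []      ()
≺-truncate []       _  (_ ∷ _) _            ()
≺-truncate (_ ∷ _)  _  []      ()
≺-truncate (a ∷ u₁) u₂ (b ∷ w) (≺-here a<b) _                = ≺-here a<b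
≺-truncate (a ∷ u₁) u₂ (a ∷ w) (≺-there p)  (s≤s ∣w∣≤∣u₁∣) = ≺-there (≺-truncate u₁ u₂ w p ∣w∣≤∣u₁∣)

≺-split : ∀ {u} c t → u ≺ (c ++ t) → u ≺ c ⊎ ∃[ s ] (u ≡ c ++ s × s ≺ t)
≺-split []      t p            = inj₂ (_ , refl , p)
≺-split (b ∷ c) t (≺-here a<b) = inj₁ (≺-here a<b)
≺-split (b ∷ c) t (≺-there p) with ≺-split c t p
... | inj₁ q           = inj₁ (≺-there q)
... | inj₂ (s , e , q) = inj₂ (s , cong (b ∷_) e , q)

≺-sameLength : ∀ u w {s t} → (u ++ s) ≺ (w ++ t) → length u ≡ length w → u ≺ w ⊎ u ≡ w
≺-sameLength []      []      _ _ = inj₂ refl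
≺-sameLength (a ∷ u) (b ∷ w) (≺-here a<b) _ = inj₁ (≺-here a<b)
≺-sameLength (a ∷ u) (a ∷ w) (≺-there p) e with ≺-sameLength u w p (suc-injective e)
... | inj₁ q = inj₁ (≺-there q)
... | inj₂ q = inj₂ (cong (a ∷_) q)

<ₗ⇒≺ : ∀ {u w} → u <ₗ w → length w ≤ length u → u ≺ w
<ₗ⇒≺ []<∷        ()
<ₗ⇒≺ (here a<b) _              = ≺-here a<b
<ₗ⇒≺ (there p)  (s≤s ∣w∣≤∣u∣) = ≺-there (<ₗ⇒≺ p ∣w∣≤∣u∣)

≤ₗᵇ-refl : ∀ u → (u ≤ₗᵇ u) ≡ true
≤ₗᵇ-refl []      = refl
≤ₗᵇ-refl (a ∷ u) rewrite ≡ᵇ-refl a = ≤ₗᵇ-refl u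

≺⇒≤ₗᵇ : ∀ {u w} → u ≺ w → (u ≤ₗᵇ w) ≡ true
≺⇒≤ₗᵇ (≺-here a<b) rewrite ≢⇒≡ᵇ-false (<⇒≢ a<b) = ≤⇒≤ᵇ-true (<⇒≤ a<b)
≺⇒≤ₗᵇ (≺-there {a} p) rewrite ≡ᵇ-refl a = ≺⇒≤ₗᵇ p

≺⇒≰ₗᵇ : ∀ {u w} → u ≺ w → (w ≤ₗᵇ u) ≡ false
≺⇒≰ₗᵇ (≺-here a<b) rewrite ≢⇒≡ᵇ-false (>⇒≢ a<b) = >⇒≤ᵇ-false a<b
≺⇒≰ₗᵇ (≺-there {a} p) rewrite ≡ᵇ-refl a = ≺⇒≰ₗᵇ p

≤ₗᵇ-both-≺ : ∀ {u w u′ w′} → u ≺ w → u′ ≺ w′ → (u′ ≤ₗᵇ w′) ≡ (u ≤ₗᵇ w)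
≤ₗᵇ-both-≺ p p′ = trans (≺⇒≤ₗᵇ p′) (sym (≺⇒≤ₗᵇ p))

≤ₗᵇ-both-≻ : ∀ {u w u′ w′} → w ≺ u → w′ ≺ u′ → (u′ ≤ₗᵇ w′) ≡ (u ≤ₗᵇ w)
≤ₗᵇ-both-≻ p p′ = trans (≺⇒≰ₗᵇ p′) (sym (≺⇒≰ₗᵇ p))

data Compare : Word → Word → Set where
  less      : ∀ {u w} → u ≺ w → Compare u w
  greater   : ∀ {u w} → w ≺ u → Compare u w
  equal     : ∀ {u} → Compare u u
  prefix    : ∀ u {c} → c ≢ [] → Compare u (u ++ c)
  extension : ∀ w {c} → c ≢ [] → Compare (w ++ c) w

compare : ∀ u w → Compare u w
compare []      []      = equal
compare []      (b ∷ w) = prefix [] (λ ())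
compare (a ∷ u) []      = extension [] (λ ())
compare (a ∷ u) (b ∷ w) with <-cmp a b
... | tri< a<b _ _ = less (≺-here a<b)
... | tri> _ _ b<a = greater (≺-here b<a)
... | tri≈ _ refl _ with compare u w
...   | less p           = less (≺-there p)
...   | greater p        = greater (≺-there p)
...   | equal            = equal
...   | prefix _ c≢[]    = prefix (a ∷ u) c≢[]
...   | extension _ c≢[] = extension (a ∷ w) c≢[]

≢[]⇒0<length : ∀ {u : Word} → u ≢ [] → 0 < length u
≢[]⇒0<length {[]}    u≢[] = ⊥-elim (u≢[] refl)
≢[]⇒0<length {_ ∷ _} _    = s≤s z≤n

++-nonemptyʳ : ∀ (u : Word) {w} → w ≢ [] → u ++ w ≢ []
++-nonemptyʳ u w≢[] = w≢[] ∘ ++-conicalʳ u _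

drop-nonempty : ∀ i (u : Word) → i < length u → drop i u ≢ []
drop-nonempty 0       (_ ∷ _) _ ()
drop-nonempty (suc i) (_ ∷ u) (s≤s i<∣u∣) = drop-nonempty i u i<∣u∣

drop-++ : ∀ i (u w : Word) → i ≤ length u → drop i (u ++ w) ≡ drop i u ++ w
drop-++ 0       u       w _ = refl
drop-++ (suc i) (a ∷ u) w (s≤s i≤∣u∣) = drop-++ i u w i≤∣u∣

take-++ : ∀ i (u w : Word) → i ≤ length u → take i (u ++ w) ≡ take i u
take-++ 0       u       w _ = refl
take-++ (suc i) (a ∷ u) w (s≤s i≤∣u∣) = cong (a ∷_) (take-++ i u w i≤∣u∣)

rot-++ : ∀ u w → rot (length u) (u ++ w) ≡ w ++ u
rot-++ u w = cong₂ _++_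
  (trans (drop-++ (length u) u w ≤-refl) (cong (_++ w) (drop-all (length u) u ≤-refl)))
  (trans (take-++ (length u) u w ≤-refl) (take-all (length u) u ≤-refl))

rot-++-∷ʳ : ∀ i u x → i ≤ length u → rot i (u ++ x ∷ []) ≡ drop i u ++ x ∷ take i u
rot-++-∷ʳ i u x i≤∣u∣
  rewrite drop-++ i u (x ∷ []) i≤∣u∣ | take-++ i u (x ∷ []) i≤∣u∣ =
  ++-assoc (drop i u) (x ∷ []) (take i u)

lyndon-≺-rotation : ∀ {v} → IsLyndon v → ∀ {u w} → u ≢ [] → w ≢ [] → v ≡ u ++ w → v ≺ w ++ u
lyndon-≺-rotation (_ , smallest) {u} {w} u≢[] w≢[] refl =
  <ₗ⇒≺ (subst ((u ++ w) <ₗ_) (rot-++ u w) (smallest (length u) (≢[]⇒0<length u≢[]) ∣u∣<∣uw∣))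
       (≤-reflexive (length-++-comm w u))
  where
  ∣u∣<∣uw∣ : length u < length (u ++ w)
  ∣u∣<∣uw∣ = subst (length u <_) (sym (length-++ u)) (m<m+n (length u) (≢[]⇒0<length w≢[]))

lyndon-border-≼ : ∀ {v} → IsLyndon v → ∀ {p c t} → c ≢ [] → t ≢ [] →
  v ≡ p ++ c → v ≡ c ++ t → p ≺ t ⊎ p ≡ t
lyndon-border-≼ lyn {p} {c} {t} c≢[] t≢[] v≡pc v≡ct =
  ≺-sameLength p t (subst (_≺ t ++ c) v≡pc (lyndon-≺-rotation lyn c≢[] t≢[] v≡ct)) ∣p∣≡∣t∣
  where
  open ≡-Reasoning
  ∣p∣≡∣t∣ : length p ≡ length t
  ∣p∣≡∣t∣ = +-cancelʳ-≡ (length c) (length p) (length t) (begin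
    length p + length c ≡⟨ length-++ p ⟨
    length (p ++ c)     ≡⟨ cong length (trans (sym v≡pc) v≡ct) ⟩
    length (c ++ t)     ≡⟨ length-++-comm c t ⟩
    length (t ++ c)     ≡⟨ length-++ t ⟩
    length t + length c ∎)

lyndon-≺-suffix : ∀ {v} → IsLyndon v → ∀ {p c} → p ≢ [] → c ≢ [] → v ≡ p ++ c → v ≺ c
lyndon-≺-suffix lyn {p} {c} p≢[] c≢[] v≡pc with ≺-split c p (lyndon-≺-rotation lyn p≢[] c≢[] v≡pc)
... | inj₁ v≺c = v≺c
... | inj₂ (t , v≡ct , t≺p) with lyndon-border-≼ lyn c≢[] (≺-nonemptyˡ t≺p) v≡pc v≡ct
...   | inj₁ p≺t  = ⊥-elim (≺-asym p≺t t≺p)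
...   | inj₂ refl = ⊥-elim (≺-irrefl t≺p)

cons-≺-suffix : ∀ {v x} → IsLyndon v → LeAll x v → ∀ {p c} → p ≢ [] → c ≢ [] → v ≡ p ++ c → (x ∷ v) ≺ c
cons-≺-suffix lyn x≤v {[]}     p≢[] _    _ = ⊥-elim (p≢[] refl)
cons-≺-suffix lyn x≤v {_ ∷ _} {[]} _ c≢[] _ = ⊥-elim (c≢[] refl)
cons-≺-suffix {x = x} lyn x≤v {a ∷ p} {b ∷ c} p≢[] c≢[] refl
  with lyndon-≺-suffix lyn p≢[] c≢[] refl | m≤n⇒m<n∨m≡n (x≤v (here refl))
... | ≺-here a<b | _         = ≺-here (≤-<-trans (x≤v (here refl)) a<b)
... | ≺-there _  | inj₁ x<a  = ≺-here x<a
... | ≺-there q  | inj₂ refl =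
  ≺-there (lyndon-≺-suffix lyn {x ∷ p ++ x ∷ []} (λ ()) (≺-nonemptyʳ q)
                           (cong (x ∷_) (sym (++-assoc p (x ∷ []) c))))

cons-≺-snoc : ∀ {v x} → IsLyndon v → LeAll x v → 2 ≤ length v → (x ∷ v) ≺ (v ++ x ∷ [])
cons-≺-snoc {_ ∷ []} _ _ (s≤s ())
cons-≺-snoc {a ∷ b ∷ v} {x} lyn x≤v _ with m≤n⇒m<n∨m≡n (x≤v (here refl))
... | inj₁ x<a  = ≺-here x<a
... | inj₂ refl = ≺-there (≺-extendʳ (x ∷ []) (lyndon-≺-suffix lyn {x ∷ []} (λ ()) (λ ()) refl))

cons-≺-rotation : ∀ {v x} → IsLyndon v → LeAll x v → 2 ≤ length v →
  ∀ {t r} → r ≢ [] → v ≡ t ++ r → (x ∷ v) ≺ (r ++ x ∷ t)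
cons-≺-rotation lyn x≤v 2≤∣v∣ {[]}    _    refl = cons-≺-snoc lyn x≤v 2≤∣v∣
cons-≺-rotation {x = x} lyn x≤v _ {a ∷ t} r≢[] v≡tr =
  ≺-extendʳ (x ∷ a ∷ t) (cons-≺-suffix lyn x≤v (λ ()) r≢[] v≡tr)

-- Here v = t₁ r = t₂ r c, so c is a proper suffix of v with |c| ≤ |t₁|; as v ≺ c and
-- x v ≺ c, already t₁ ≺ c and x t₁ ≺ c.
prefix-rotations-≺ : ∀ {v x} → IsLyndon v → LeAll x v → ∀ {t₁ t₂ r c} → r ≢ [] → c ≢ [] →
  v ≡ t₁ ++ r → v ≡ t₂ ++ (r ++ c) →
  (r ++ t₁) ≺ ((r ++ c) ++ t₂) × (r ++ x ∷ t₁) ≺ ((r ++ c) ++ x ∷ t₂)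
prefix-rotations-≺ {v} {x} lyn x≤v {t₁} {t₂} {r} {c} r≢[] c≢[] v≡t₁r v≡t₂rc =
  subst (r ++ t₁ ≺_) (sym (++-assoc r c t₂)) (≺-prepend r (≺-extendʳ t₂ t₁≺c)) ,
  subst (r ++ x ∷ t₁ ≺_) (sym (++-assoc r c (x ∷ t₂))) (≺-prepend r (≺-extendʳ (x ∷ t₂) xt₁≺c))
  where
  v≡t₂r++c : v ≡ (t₂ ++ r) ++ c
  v≡t₂r++c = trans v≡t₂rc (sym (++-assoc t₂ r c))
  t₂r≢[] : t₂ ++ r ≢ []
  t₂r≢[] = ++-nonemptyʳ t₂ r≢[]
  ∣c∣≤∣t₁∣ : length c ≤ length t₁
  ∣c∣≤∣t₁∣ = +-cancelʳ-≤ (length r) (length c) (length t₁) (begin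
    length c + length r     ≡⟨ length-++ c ⟨
    length (c ++ r)         ≡⟨ length-++-comm c r ⟩
    length (r ++ c)         ≤⟨ length-++-≤ʳ (r ++ c) {t₂} ⟩
    length (t₂ ++ (r ++ c)) ≡⟨ cong length (trans (sym v≡t₂rc) v≡t₁r) ⟩
    length (t₁ ++ r)        ≡⟨ length-++ t₁ ⟩
    length t₁ + length r    ∎)
    where open ≤-Reasoning
  t₁≺c : t₁ ≺ c
  t₁≺c = ≺-truncate t₁ r c (subst (_≺ c) v≡t₁r (lyndon-≺-suffix lyn t₂r≢[] c≢[] v≡t₂r++c)) ∣c∣≤∣t₁∣
  xt₁≺c : (x ∷ t₁) ≺ c
  xt₁≺c = ≺-truncate (x ∷ t₁) r c
    (subst (λ u → (x ∷ u) ≺ c) v≡t₁r (cons-≺-suffix lyn x≤v t₂r≢[] c≢[] v≡t₂r++c)) (m≤n⇒m≤1+n ∣c∣≤∣t₁∣)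

rotation-order-insert : ∀ {v x} → IsLyndon v → LeAll x v → ∀ {t₁ t₂ r₁ r₂} → r₁ ≢ [] → r₂ ≢ [] →
  v ≡ t₁ ++ r₁ → v ≡ t₂ ++ r₂ →
  ((r₁ ++ x ∷ t₁) ≤ₗᵇ (r₂ ++ x ∷ t₂)) ≡ ((r₁ ++ t₁) ≤ₗᵇ (r₂ ++ t₂))
rotation-order-insert lyn x≤v {t₁} {t₂} {r₁} {r₂} r₁≢[] r₂≢[] v≡t₁r₁ v≡t₂r₂ with compare r₁ r₂
... | less p    = ≤ₗᵇ-both-≺ (≺-extend t₁ t₂ p) (≺-extend _ _ p)
... | greater p = ≤ₗᵇ-both-≻ (≺-extend t₂ t₁ p) (≺-extend _ _ p)
... | equal with ++-cancelʳ r₁ t₁ t₂ (trans (sym v≡t₁r₁) v≡t₂r₂)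
...   | refl = trans (≤ₗᵇ-refl (r₁ ++ _ ∷ t₁)) (sym (≤ₗᵇ-refl (r₁ ++ t₁)))
rotation-order-insert lyn x≤v r₁≢[] r₂≢[] v≡t₁r₁ v≡t₂r₂ | prefix _ c≢[] =
  let p , p′ = prefix-rotations-≺ lyn x≤v r₁≢[] c≢[] v≡t₁r₁ v≡t₂r₂ in ≤ₗᵇ-both-≺ p p′
rotation-order-insert lyn x≤v r₁≢[] r₂≢[] v≡t₁r₁ v≡t₂r₂ | extension _ c≢[] =
  let p , p′ = prefix-rotations-≺ lyn x≤v r₂≢[] c≢[] v≡t₂r₂ v≡t₁r₁ in ≤ₗᵇ-both-≻ p p′

module _ {A : Set} where

  insertBy : (A → A → Bool) → A → List A → List A
  insertBy le a []       = a ∷ []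
  insertBy le a (b ∷ bs) = if le a b then a ∷ b ∷ bs else b ∷ insertBy le a bs

  sortBy : (A → A → Bool) → List A → List A
  sortBy le []       = []
  sortBy le (a ∷ as) = insertBy le a (sortBy le as)

  All-insertBy : ∀ {P : A → Set} le {a bs} → P a → All P bs → All P (insertBy le a bs)
  All-insertBy le pa []                 = pa ∷ []
  All-insertBy le {a} {b ∷ _} pa (pb ∷ pbs) with le a b
  ... | true  = pa ∷ pb ∷ pbs
  ... | false = pb ∷ All-insertBy le pa pbs

  All-sortBy : ∀ {P : A → Set} le {as} → All P as → All P (sortBy le as)
  All-sortBy le []         = []
  All-sortBy le (pa ∷ pas) = All-insertBy le pa (All-sortBy le pas)

  insertBy-least : ∀ le {a bs} → All (λ b → le a b ≡ true) bs → insertBy le a bs ≡ a ∷ bs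
  insertBy-least le []                = refl
  insertBy-least le (a≤b ∷ _) rewrite a≤b = refl

  module _ {P : A → Set} (g : A → Word) (le : A → A → Bool)
           (g-order : ∀ {i j} → P i → P j → (g i ≤ₗᵇ g j) ≡ le i j) where

    insert-map : ∀ {a bs} → P a → All P bs → insert (g a) (map g bs) ≡ map g (insertBy le a bs)
    insert-map pa []                 = refl
    insert-map {a} {b ∷ _} pa (pb ∷ pbs) rewrite g-order pa pb with le a b
    ... | true  = refl
    ... | false = cong (g b ∷_) (insert-map pa pbs)

    sortW-map : ∀ {as} → All P as → sortW (map g as) ≡ map g (sortBy le as)
    sortW-map []                   = refl
    sortW-map (pa ∷ pas) rewrite sortW-map pas = insert-map pa (All-sortBy le pas)

insert-≤ₗᵇ-head : ∀ {u w ws} → (u ≤ₗᵇ w) ≡ true → insert u (w ∷ ws) ≡ u ∷ w ∷ ws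
insert-≤ₗᵇ-head u≤w rewrite u≤w = refl

sortW-∷ʳ-least : ∀ {y us} → All (λ u → (u ≤ₗᵇ y) ≡ false) us → sortW (us ++ y ∷ []) ≡ y ∷ sortW us
sortW-∷ʳ-least []           = refl
sortW-∷ʳ-least (u≰y ∷ u≰ys) rewrite sortW-∷ʳ-least u≰ys | u≰y = refl

last-∷-just : ∀ a (u : Word) → ∃[ c ] last (a ∷ u) ≡ just c
last-∷-just a []      = a , refl
last-∷-just a (b ∷ u) = last-∷-just b u

last-++-∷ : ∀ (u : Word) a w → last (u ++ a ∷ w) ≡ last (a ∷ w)
last-++-∷ []          a w = refl
last-++-∷ (b ∷ [])    a w = refl
last-++-∷ (b ∷ c ∷ u) a w = last-++-∷ (c ∷ u) a w

last-++-insert : ∀ (u : Word) x {t} → t ≢ [] → last (u ++ x ∷ t) ≡ last (u ++ t)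
last-++-insert u x {[]}    t≢[] = ⊥-elim (t≢[] refl)
last-++-insert u x {a ∷ t} _    = trans (last-++-∷ u x (a ∷ t)) (sym (last-++-∷ u a t))

lastChars-∷ : ∀ u {us c} → last u ≡ just c → lastChars (u ∷ us) ≡ c ∷ lastChars us
lastChars-∷ _ last-u rewrite last-u = refl

lastChars-map-cong : ∀ {f g : ℕ → Word} {is} → All (λ i → last (f i) ≡ last (g i)) is →
  lastChars (map f is) ≡ lastChars (map g is)
lastChars-map-cong []                = refl
lastChars-map-cong {f} {g} {i ∷ _} (eq ∷ eqs) with last (f i) | last (g i) | eq
... | just c  | _ | refl = cong (c ∷_) (lastChars-map-cong eqs)
... | nothing | _ | refl = lastChars-map-cong eqs

runsFrom-≤ : ∀ a b u → runsFrom a u ≤ suc (runsFrom b u)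
runsFrom-≤ a b []      = z≤n
runsFrom-≤ a b (c ∷ u) with a ≡ᵇ c | b ≡ᵇ c
... | true  | true  = n≤1+n _
... | true  | false = m≤n⇒m≤1+n (n≤1+n _)
... | false | true  = ≤-refl
... | false | false = n≤1+n _

runs-insert-≥ : ∀ a x u → runs (a ∷ u) ≤ runs (a ∷ x ∷ u)
runs-insert-≥ a x u with a ≟ x
... | yes refl rewrite ≡ᵇ-refl a = ≤-refl
... | no a≢x  rewrite ≢⇒≡ᵇ-false a≢x = s≤s (runsFrom-≤ a x u)

runs-insert-≤ : ∀ a x u → runs (a ∷ x ∷ u) ≤ runs (a ∷ u) + 2
runs-insert-≤ a x u with a ≟ x
... | yes refl rewrite ≡ᵇ-refl a = m≤m+n _ 2
... | no a≢x  rewrite ≢⇒≡ᵇ-false a≢x =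
  ≤-trans (s≤s (s≤s (runsFrom-≤ x a u))) (≤-reflexive (sym (+-comm (runs (a ∷ u)) 2)))

HasTwoDistinct⇒2≤length : ∀ {v} → HasTwoDistinct v → 2 ≤ length v
HasTwoDistinct⇒2≤length {[]}          (_ , _ , () , _)
HasTwoDistinct⇒2≤length {_ ∷ []}      (_ , _ , here refl , here refl , a≢b) = ⊥-elim (a≢b refl)
HasTwoDistinct⇒2≤length {_ ∷ []}      (_ , _ , there () , _)
HasTwoDistinct⇒2≤length {_ ∷ []}      (_ , _ , _ , there () , _)
HasTwoDistinct⇒2≤length {_ ∷ _ ∷ _}   _ = s≤s (s≤s z≤n)

module LetterExtension {m : ℕ} {v′ : Word} {x : ℕ}
  (lyn : IsLyndon (m ∷ v′)) (x≤v : LeAll x (m ∷ v′)) (2≤∣v∣ : 2 ≤ length (m ∷ v′)) where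

  v : Word
  v = m ∷ v′

  n : ℕ
  n = length v

  rotᵛ : ℕ → Word
  rotᵛ i = rot i v

  rotᵛˣ : ℕ → Word
  rotᵛˣ i = drop i v ++ x ∷ take i v

  order : ℕ → ℕ → Bool
  order i j = rotᵛ i ≤ₗᵇ rotᵛ j

  v-split : ∀ i → v ≡ take i v ++ drop i v
  v-split i = sym (take++drop≡id i v)

  take-nonempty : ∀ {j} → 0 < j → take j v ≢ []
  take-nonempty {suc _} _ ()

  rotᵛˣ-order : ∀ {i j} → i < n → j < n → (rotᵛˣ i ≤ₗᵇ rotᵛˣ j) ≡ order i j
  rotᵛˣ-order {i} {j} i<n j<n =
    rotation-order-insert lyn x≤v (drop-nonempty i v i<n) (drop-nonempty j v j<n) (v-split i) (v-split j)

  rotᵛ-0-least : ∀ {j} → 0 < j × j < n → order 0 j ≡ true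
  rotᵛ-0-least {j} (0<j , j<n) = subst (λ u → (u ≤ₗᵇ rotᵛ j) ≡ true) (sym (++-identityʳ v))
    (≺⇒≤ₗᵇ (≺-extendʳ (take j v)
      (lyndon-≺-suffix lyn (take-nonempty 0<j) (drop-nonempty j v j<n) (v-split j))))

  S : List ℕ
  S = sortBy order (applyUpTo suc (length v′))

  S-bounds : All (λ j → 0 < j × j < n) S
  S-bounds = All-sortBy order (applyUpTo⁺₁ suc (length v′) (λ i<k → s≤s z≤n , s≤s i<k))

  upTo-bounds : All (_< n) (upTo n)
  upTo-bounds = applyUpTo⁺₁ id n id

  sortBy-upTo : sortBy order (upTo n) ≡ 0 ∷ S
  sortBy-upTo = insertBy-least order (All.map rotᵛ-0-least S-bounds)

  sort-conjugates-v : sortW (conjugates v) ≡ rotᵛ 0 ∷ map rotᵛ S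
  sort-conjugates-v =
    trans (sortW-map rotᵛ order (λ _ _ → refl) upTo-bounds) (cong (map rotᵛ) sortBy-upTo)

  sort-rotᵛˣ : sortW (map rotᵛˣ (upTo n)) ≡ rotᵛˣ 0 ∷ map rotᵛˣ S
  sort-rotᵛˣ = trans (sortW-map rotᵛˣ order rotᵛˣ-order upTo-bounds) (cong (map rotᵛˣ) sortBy-upTo)

  conjugates-snoc : conjugates (v ++ x ∷ []) ≡ map rotᵛˣ (upTo n) ++ (x ∷ v) ∷ []
  conjugates-snoc = begin
    map rotʷ (upTo (length w))     ≡⟨ cong (map rotʷ ∘ upTo) (length-++-comm v (x ∷ [])) ⟩
    map rotʷ (upTo (suc n))        ≡⟨ cong (map rotʷ) (upTo-∷ʳ n) ⟨
    map rotʷ (upTo n ++ n ∷ [])    ≡⟨ map-++ rotʷ (upTo n) (n ∷ []) ⟩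
    map rotʷ (upTo n) ++ rotʷ n ∷ [] ≡⟨ cong₂ (λ us u → us ++ u ∷ []) rotʷ-below-n (rot-++ v (x ∷ [])) ⟩
    map rotᵛˣ (upTo n) ++ (x ∷ v) ∷ [] ∎
    where
    open ≡-Reasoning
    w : Word
    w = v ++ x ∷ []
    rotʷ : ℕ → Word
    rotʷ i = rot i w
    rotʷ-below-n : map rotʷ (upTo n) ≡ map rotᵛˣ (upTo n)
    rotʷ-below-n = map-cong-local (All.map (λ i<n → rot-++-∷ʳ _ v x (<⇒≤ i<n)) upTo-bounds)

  conjugates-cons : conjugates (x ∷ v) ≡ ((x ∷ v) ++ []) ∷ map rotᵛˣ (upTo n)
  conjugates-cons = cong (((x ∷ v) ++ []) ∷_)
    (trans (map-applyUpTo suc (λ i → rot i (x ∷ v)) n) (sym (map-applyUpTo id rotᵛˣ n)))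

  sort-conjugates-snoc : sortW (conjugates (v ++ x ∷ [])) ≡ (x ∷ v) ∷ rotᵛˣ 0 ∷ map rotᵛˣ S
  sort-conjugates-snoc = begin
    sortW (conjugates (v ++ x ∷ []))
      ≡⟨ cong sortW conjugates-snoc ⟩
    sortW (map rotᵛˣ (upTo n) ++ (x ∷ v) ∷ [])
      ≡⟨ sortW-∷ʳ-least (map⁺ (All.map rotᵛˣ≰cons upTo-bounds)) ⟩
    (x ∷ v) ∷ sortW (map rotᵛˣ (upTo n))
      ≡⟨ cong ((x ∷ v) ∷_) sort-rotᵛˣ ⟩
    (x ∷ v) ∷ rotᵛˣ 0 ∷ map rotᵛˣ S ∎
    where
    open ≡-Reasoning
    rotᵛˣ≰cons : ∀ {i} → i < n → (rotᵛˣ i ≤ₗᵇ (x ∷ v)) ≡ false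
    rotᵛˣ≰cons {i} i<n = ≺⇒≰ₗᵇ (cons-≺-rotation lyn x≤v 2≤∣v∣ (drop-nonempty i v i<n) (v-split i))

  sort-conjugates-cons : sortW (conjugates (x ∷ v)) ≡ (x ∷ v) ∷ rotᵛˣ 0 ∷ map rotᵛˣ S
  sort-conjugates-cons = begin
    sortW (conjugates (x ∷ v))
      ≡⟨ cong sortW conjugates-cons ⟩
    insert ((x ∷ v) ++ []) (sortW (map rotᵛˣ (upTo n)))
      ≡⟨ cong₂ insert (++-identityʳ (x ∷ v)) sort-rotᵛˣ ⟩
    insert (x ∷ v) (rotᵛˣ 0 ∷ map rotᵛˣ S)
      ≡⟨ insert-≤ₗᵇ-head (≺⇒≤ₗᵇ (cons-≺-snoc lyn x≤v 2≤∣v∣)) ⟩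
    (x ∷ v) ∷ rotᵛˣ 0 ∷ map rotᵛˣ S ∎
    where open ≡-Reasoning

  L : ℕ
  L = proj₁ (last-∷-just m v′)

  last-v : last v ≡ just L
  last-v = proj₂ (last-∷-just m v′)

  B : Word
  B = lastChars (map rotᵛ S)

  BWT-v : BWT v ≡ L ∷ B
  BWT-v = trans (cong lastChars sort-conjugates-v)
                (lastChars-∷ (v ++ []) (trans (cong last (++-identityʳ v)) last-v))

  lastChars-extension : lastChars ((x ∷ v) ∷ rotᵛˣ 0 ∷ map rotᵛˣ S) ≡ L ∷ x ∷ B
  lastChars-extension = begin
    lastChars ((x ∷ v) ∷ rotᵛˣ 0 ∷ map rotᵛˣ S)
      ≡⟨ lastChars-∷ (x ∷ v) last-v ⟩
    L ∷ lastChars (rotᵛˣ 0 ∷ map rotᵛˣ S)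
      ≡⟨ cong (L ∷_) (lastChars-∷ (rotᵛˣ 0) (last-++-∷ v x [])) ⟩
    L ∷ x ∷ lastChars (map rotᵛˣ S)
      ≡⟨ cong (λ u → L ∷ x ∷ u) (lastChars-map-cong (All.map last-rotᵛˣ S-bounds)) ⟩
    L ∷ x ∷ B ∎
    where
    open ≡-Reasoning
    last-rotᵛˣ : ∀ {j} → 0 < j × j < n → last (rotᵛˣ j) ≡ last (rotᵛ j)
    last-rotᵛˣ {j} (0<j , _) = last-++-insert (drop j v) x (take-nonempty 0<j)

  BWT-cons : BWT (x ∷ v) ≡ L ∷ x ∷ B
  BWT-cons = trans (cong lastChars sort-conjugates-cons) lastChars-extension

  BWT-snoc : BWT (v ++ x ∷ []) ≡ L ∷ x ∷ B
  BWT-snoc = trans (cong lastChars sort-conjugates-snoc) lastChars-extension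

lemma8 : (v : Word) (x : ℕ) → IsLyndon v → HasTwoDistinct v → LeAll x v →
    (r v ≤ r (x ∷ v)) × (r (x ∷ v) ≡ r (v ++ x ∷ [])) × (r (v ++ x ∷ []) ≤ r v + 2)
lemma8 [] x (() , _) _ _
lemma8 (m ∷ v′) x lyn two x≤v = r-grows , cong runs (trans BWT-cons (sym BWT-snoc)) , r-bounded
  where
  open LetterExtension lyn x≤v (HasTwoDistinct⇒2≤length two) using (L; B; BWT-v; BWT-cons; BWT-snoc)
  open ≤-Reasoning
  r-grows : r (m ∷ v′) ≤ r (x ∷ m ∷ v′)
  r-grows = begin
    r (m ∷ v′)        ≡⟨ cong runs BWT-v ⟩
    runs (L ∷ B)      ≤⟨ runs-insert-≥ L x B ⟩
    runs (L ∷ x ∷ B)  ≡⟨ cong runs BWT-cons ⟨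
    r (x ∷ m ∷ v′)    ∎
  r-bounded : r ((m ∷ v′) ++ x ∷ []) ≤ r (m ∷ v′) + 2
  r-bounded = begin
    r ((m ∷ v′) ++ x ∷ []) ≡⟨ cong runs BWT-snoc ⟩
    runs (L ∷ x ∷ B)       ≤⟨ runs-insert-≤ L x B ⟩
    runs (L ∷ B) + 2       ≡⟨ cong (λ u → runs u + 2) BWT-v ⟨
    r (m ∷ v′) + 2         ∎
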